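{- For any integer $k\ge 2$, $$r_k(K_3)\le r_{4k}(K_4^{3}-e)\quad\text{and}\quad r_{k}(K_4^{3}-e)\le r_{k}(K_3)+1.$$ Moreover $r_2(K_4^3-e)=r_2(K_3)+1=7$.
   Context: $K_4^3-e$ is the $3$-uniform hypergraph obtained from the complete $3$-uniform hypergraph $K_4^3$ on $4$ vertices by deleting one edge, i.e. edge set $\{abc,abd,acd\}$. $K_3$ is the triangle graph. For a $3$-uniform hypergraph $H$, $r_k(H)$ is the minimum $n$ such that every $k$-coloring of the triples of an $n$-set contains a monochromatic copy of $H$; for a graph $G$, $r_k(G)$ is the minimum $n$ such that every $k$-coloring of the edges of $K_n$ contains a monochromatic copy of $G$. -}

module Defs where

open import Data.Nat using (ℕ; _<_)
open import Data.Fin using (Fin)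
open import Data.Product using (Σ; _×_; ∃-syntax)
open import Relation.Binary.PropositionalEquality using (_≡_; _≢_)
open import Relation.Nullary using (¬_)

-- A k-colouring of the edges of K_n: a symmetric function on pairs of
-- vertices of Fin n (values on loops x = x are irrelevant).
SymColouring2 : (n k : ℕ) → Set
SymColouring2 n k =
  Σ (Fin n → Fin n → Fin k) λ c → ∀ x y → c x y ≡ c y x

-- A k-colouring of the triples of an n-set: a function on ordered triples
-- invariant under all permutations (generated by two transpositions);
-- values on triples with repeated entries are irrelevant.
SymColouring3 : (n k : ℕ) → Set
SymColouring3 n k =
  Σ (Fin n → Fin n → Fin n → Fin k) λ c →
    (∀ x y z → c x y z ≡ c y x z) × (∀ x y z → c x y z ≡ c x z y)

HasMonoK3 : ∀ {n k} → (Fin n → Fin n → Fin k) → Set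
HasMonoK3 {n} c = ∃[ x ] ∃[ y ] ∃[ z ]
  (x ≢ y × x ≢ z × y ≢ z) × (c x y ≡ c x z × c x y ≡ c y z)

HasMonoK43e : ∀ {n k} → (Fin n → Fin n → Fin n → Fin k) → Set
HasMonoK43e {n} col = ∃[ a ] ∃[ b ] ∃[ c ] ∃[ d ]
  (a ≢ b × a ≢ c × a ≢ d × b ≢ c × b ≢ d × c ≢ d) ×
  (col a b c ≡ col a b d × col a b c ≡ col a c d)

ArrowsK3 : (k n : ℕ) → Set
ArrowsK3 k n = (col : SymColouring2 n k) → HasMonoK3 (Data.Product.proj₁ col)

ArrowsK43e : (k n : ℕ) → Set
ArrowsK43e k n = (col : SymColouring3 n k) → HasMonoK43e (Data.Product.proj₁ col)

IsMin : (ℕ → Set) → ℕ → Set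
IsMin P r = P r × (∀ m → m < r → ¬ P m)

IsRamseyK3 : ℕ → ℕ → Set
IsRamseyK3 k r = IsMin (ArrowsK3 k) r

IsRamseyK43e : ℕ → ℕ → Set
IsRamseyK43e k r = IsMin (ArrowsK43e k) r

module Submission where

-- From an edge colouring c of K_n with k
--     colours build a colouring of triples with 4k colours: a triple
--     x < y < z receives the "shape" of its triangle, i.e. whether
--     c(xy) = c(xz), whether c(xy) = c(yz), and one edge colour (that of yz
--     if c(xy) = c(xz), otherwise that of xy).  If four vertices p < q < r < t
--     carry a monochromatic K₄³ - e, its three triples share a vertex (the
--     centre); for each of the four possible positions of the centre a short
--     case analysis on the common shape yields a monochromatic triangle.
--     The triple colouring is made symmetric by evaluating it on sorted
--     arguments, computed with min/max in the total order of Fin n.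
-- (2) r_k(K₄³ - e) ≤ r_k(K₃) + 1.  The link of one vertex of a triple
--     colouring is an edge colouring of the others; a monochromatic triangle
--     there is a monochromatic K₄³ - e centred at that vertex.
-- (3) r₂(K₃) = 6 and hence, with (2), r₂(K₄³ - e) = 7.  The upper bound for
--     K₃ is the pigeonhole argument at one vertex of K₆; the lower bounds
--     are explicit colourings of K₅ (the pentagon) and of the triples of a
--     6-set, checked by exhaustive decision procedures.
-- The arrow properties are monotone in the number of vertices, so a
-- threshold with a positive case at r and a negative case at r - 1 is a
-- minimum; this turns (1)-(3) into the statements about Ramsey numbers.

open import Defs
open import Data.Nat using (ℕ; _≤_; _*_; _+_; s≤s; _%_; ∣_-_∣)
open import Data.Nat.Properties using (_≤?_; <⇒≤; ≰⇒>; +-comm; +-assoc; ∣-∣-comm)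
open import Data.Fin using (Fin; zero; suc; toℕ; inject≤; combine)
  renaming (_<_ to _<ᶠ_; _≤_ to _≤ᶠ_)
open import Data.Fin.Patterns using (0F; 1F; 2F; 3F; 4F)
open import Data.Fin.Properties
  using (_≟_; any?; all?; <-cmp; <-trans; <⇒≢; ≤-trans; ≤-totalOrder; suc-injective;
         inject≤-injective; combine-injective)
open import Data.Bool using (Bool; true; false)
open import Data.Vec using (_∷_; []; lookup)
open import Data.Vec.Properties using (lookup∘tabulate)
open import Data.Product using (_×_; _,_; proj₁; proj₂; ∃-syntax)
open import Function using (_∘_)
open import Relation.Nullary using (Dec; yes; no; does; ¬_; ¬?; contradiction)
open import Relation.Nullary.Decidable using (_×-dec_; dec-true; from-yes; from-no)
open import Relation.Binary.Definitions using (tri<; tri≈; tri>)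
open import Relation.Binary.PropositionalEquality
import Algebra.Construct.NaturalChoice.Min as Min
import Algebra.Construct.NaturalChoice.Max as Max

-- The result is
-- invariant under permuting the arguments and fixes sorted triples, so
-- evaluating any function on sorted arguments makes it symmetric.
module Sorting {n : ℕ} where
  open Min (≤-totalOrder n)
  open Max (≤-totalOrder n)

  -- kept abstract: only the three properties below are ever needed, and
  -- unfolding min/max on open terms is expensive for the type checker
  abstract
    sort₃ : Fin n → Fin n → Fin n → Fin n × Fin n × Fin n
    sort₃ x y z = x ⊓ y ⊓ z , (x ⊓ y) ⊔ (x ⊓ z) ⊔ (y ⊓ z) , x ⊔ y ⊔ z

    private
      swap₂₃ : {_∙_ : Fin n → Fin n → Fin n} → (∀ x y → x ∙ y ≡ y ∙ x) →
               (∀ x y z → (x ∙ y) ∙ z ≡ x ∙ (y ∙ z)) →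
               ∀ x y z → (x ∙ y) ∙ z ≡ (x ∙ z) ∙ y
      swap₂₃ {_∙_} comm assoc x y z = begin
        (x ∙ y) ∙ z  ≡⟨ assoc x y z ⟩
        x ∙ (y ∙ z)  ≡⟨ cong (x ∙_) (comm y z) ⟩
        x ∙ (z ∙ y)  ≡⟨ assoc x z y ⟨
        (x ∙ z) ∙ y  ∎
        where open ≡-Reasoning

    sort₃-swap₁₂ : ∀ x y z → sort₃ x y z ≡ sort₃ y x z
    sort₃-swap₁₂ x y z =
      cong₂ _,_ (cong (_⊓ z) (⊓-comm x y)) (cong₂ _,_ median (cong (_⊔ z) (⊔-comm x y)))
      where
      median : (x ⊓ y) ⊔ (x ⊓ z) ⊔ (y ⊓ z) ≡ (y ⊓ x) ⊔ (y ⊓ z) ⊔ (x ⊓ z)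
      median rewrite ⊓-comm x y = swap₂₃ ⊔-comm ⊔-assoc (y ⊓ x) (x ⊓ z) (y ⊓ z)

    sort₃-swap₂₃ : ∀ x y z → sort₃ x y z ≡ sort₃ x z y
    sort₃-swap₂₃ x y z =
      cong₂ _,_ (swap₂₃ ⊓-comm ⊓-assoc x y z) (cong₂ _,_ median (swap₂₃ ⊔-comm ⊔-assoc x y z))
      where
      median : (x ⊓ y) ⊔ (x ⊓ z) ⊔ (y ⊓ z) ≡ (x ⊓ z) ⊔ (x ⊓ y) ⊔ (z ⊓ y)
      median = cong₂ _⊔_ (⊔-comm (x ⊓ y) (x ⊓ z)) (⊓-comm y z)

    sort₃-sorted : ∀ {x y z} → x ≤ᶠ y → y ≤ᶠ z → sort₃ x y z ≡ (x , y , z)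
    sort₃-sorted {x} {y} {z} x≤y y≤z = cong₂ _,_ minimum (cong₂ _,_ median maximum)
      where
      x≤z : x ≤ᶠ z
      x≤z = ≤-trans x≤y y≤z
      minimum : x ⊓ y ⊓ z ≡ x
      minimum rewrite x≤y⇒x⊓y≈x x≤y = x≤y⇒x⊓y≈x x≤z
      maximum : x ⊔ y ⊔ z ≡ z
      maximum rewrite x≤y⇒x⊔y≈y x≤y = x≤y⇒x⊔y≈y y≤z
      median : (x ⊓ y) ⊔ (x ⊓ z) ⊔ (y ⊓ z) ≡ y
      median = begin
        (x ⊓ y) ⊔ (x ⊓ z) ⊔ (y ⊓ z)  ≡⟨ cong₂ (λ a b → a ⊔ b ⊔ (y ⊓ z)) (x≤y⇒x⊓y≈x x≤y) (x≤y⇒x⊓y≈x x≤z) ⟩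
        x ⊔ x ⊔ (y ⊓ z)              ≡⟨ cong₂ _⊔_ (⊔-idem x) (x≤y⇒x⊓y≈x y≤z) ⟩
        x ⊔ y                        ≡⟨ x≤y⇒x⊔y≈y x≤y ⟩
        y                            ∎
        where open ≡-Reasoning

  sortDistinct : {P : Fin n → Fin n → Fin n → Set} →
    (∀ {x y z} → P x y z → P y x z) → (∀ {x y z} → P x y z → P x z y) →
    ∀ {x y z} → x ≢ y → x ≢ z → y ≢ z → P x y z →
    ∃[ u ] ∃[ v ] ∃[ w ] (u <ᶠ v × v <ᶠ w) × P u v w
  sortDistinct s₁₂ s₂₃ {x} {y} {z} x≢y x≢z y≢z p with <-cmp x y | <-cmp y z | <-cmp x z
  ... | tri≈ _ x≡y _ | _ | _ = contradiction x≡y x≢y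
  ... | _ | tri≈ _ y≡z _ | _ = contradiction y≡z y≢z
  ... | _ | _ | tri≈ _ x≡z _ = contradiction x≡z x≢z
  ... | tri< x<y _ _ | tri< y<z _ _ | _            = x , y , z , (x<y , y<z) , p
  ... | tri< x<y _ _ | tri> _ _ z<y | tri< x<z _ _ = x , z , y , (x<z , z<y) , s₂₃ p
  ... | tri< x<y _ _ | tri> _ _ _   | tri> _ _ z<x = z , x , y , (z<x , x<y) , s₁₂ (s₂₃ p)
  ... | tri> _ _ y<x | tri< _ _ _   | tri< x<z _ _ = y , x , z , (y<x , x<z) , s₁₂ p
  ... | tri> _ _ _   | tri< y<z _ _ | tri> _ _ z<x = y , z , x , (y<z , z<x) , s₂₃ (s₁₂ p)
  ... | tri> _ _ y<x | tri> _ _ z<y | _            = z , y , x , (z<y , y<x) , s₁₂ (s₂₃ (s₁₂ p))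

  applyTo : {A : Set} → (Fin n → Fin n → Fin n → A) → Fin n × Fin n × Fin n → A
  applyTo g (a , b , c) = g a b c

  symmetrise : {A : Set} → (Fin n → Fin n → Fin n → A) → Fin n → Fin n → Fin n → A
  symmetrise g x y z = applyTo g (sort₃ x y z)

  module _ {A : Set} (g : Fin n → Fin n → Fin n → A) where
    symmetrise-swap₁₂ : ∀ x y z → symmetrise g x y z ≡ symmetrise g y x z
    symmetrise-swap₁₂ x y z = cong (applyTo g) (sort₃-swap₁₂ x y z)

    symmetrise-swap₂₃ : ∀ x y z → symmetrise g x y z ≡ symmetrise g x z y
    symmetrise-swap₂₃ x y z = cong (applyTo g) (sort₃-swap₂₃ x y z)

    symmetrise-sorted : ∀ {x y z} → x <ᶠ y → y <ᶠ z → symmetrise g x y z ≡ g x y z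
    symmetrise-sorted x<y y<z = cong (applyTo g) (sort₃-sorted (<⇒≤ x<y) (<⇒≤ y<z))

open Sorting

decided : {P : Set} (d : Dec P) → does d ≡ true → P
decided (yes p) _ = p

-- Together with the reading lemmas below it says just enough about
-- the triangle to recover monochromatic triangles from K₄³ - e.
Shape : ℕ → Set
Shape k = Bool × Bool × Fin k

module _ {k : ℕ} where
  shape : Fin k → Fin k → Fin k → Shape k
  shape A B C with A ≟ B
  ... | yes _ = true  , does (A ≟ C) , C
  ... | no  _ = false , does (A ≟ C) , A

  read-AB : ∀ A B C {b v} → shape A B C ≡ (true , b , v) → A ≡ B × C ≡ v
  read-AB A B C with A ≟ B
  ... | yes A≡B = λ eq → A≡B , cong (proj₂ ∘ proj₂) eq
  ... | no  _   = λ ()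

  read-¬AB : ∀ A B C {b v} → shape A B C ≡ (false , b , v) → A ≢ B × A ≡ v
  read-¬AB A B C with A ≟ B
  ... | yes _   = λ ()
  ... | no  A≢B = λ eq → A≢B , cong (proj₂ ∘ proj₂) eq

  shape-AC : ∀ A B C → proj₁ (proj₂ (shape A B C)) ≡ does (A ≟ C)
  shape-AC A B C with A ≟ B
  ... | yes _ = refl
  ... | no  _ = refl

  read-AC : ∀ A B C {b v} → shape A B C ≡ (b , true , v) → A ≡ C
  read-AC A B C eq =
    decided (A ≟ C) (trans (sym (shape-AC A B C)) (cong (proj₁ ∘ proj₂) eq))

  read-¬AC : ∀ A B C {b v} → shape A B C ≡ (b , false , v) → A ≢ C
  read-¬AC A B C eq A≡C
    with trans (sym (dec-true (A ≟ C) A≡C)) (trans (sym (shape-AC A B C)) (cong (proj₁ ∘ proj₂) eq))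
  ... | ()

bit : Bool → Fin 2
bit false = 0F
bit true  = 1F

bit-injective : ∀ {a b} → bit a ≡ bit b → a ≡ b
bit-injective {false} {false} _ = refl
bit-injective {true}  {true}  _ = refl

encode : ∀ {k} → Shape k → Fin (4 * k)
encode (b₁ , b₂ , v) = combine (combine (bit b₁) (bit b₂)) v

encode-injective : ∀ {k} {s t : Shape k} → encode s ≡ encode t → s ≡ t
encode-injective {s = b₁ , b₂ , v} {b₁′ , b₂′ , v′} eq
  with combine-injective (combine (bit b₁) (bit b₂)) v (combine (bit b₁′) (bit b₂′)) v′ eq
... | bits , refl with combine-injective (bit b₁) (bit b₂) (bit b₁′) (bit b₂′) bits
... | e₁ , e₂ = cong₂ _,_ (bit-injective e₁) (cong (_, v) (bit-injective e₂))

Star : ∀ {n k} → (Fin n → Fin n → Fin n → Fin k) → Fin n → Fin n → Fin n → Fin n → Set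
Star col a b c d = col a b c ≡ col a b d × col a b c ≡ col a c d

module ShapeColouring {n k : ℕ} (c : Fin n → Fin n → Fin k) where

  triangleShape : Fin n → Fin n → Fin n → Shape k
  triangleShape x y z = shape (c x y) (c x z) (c y z)

  triangle : ∀ {x y z v} → x ≢ y → x ≢ z → y ≢ z →
             c x y ≡ v → c x z ≡ v → c y z ≡ v → HasMonoK3 c
  triangle {x} {y} {z} x≢y x≢z y≢z xy≡v xz≡v yz≡v =
    x , y , z , (x≢y , x≢z , y≢z) , (trans xy≡v (sym xz≡v) , trans xy≡v (sym yz≡v))

  module _ {p q r t : Fin n} (p<q : p <ᶠ q) (q<r : q <ᶠ r) (r<t : r <ᶠ t) where
    private
      triangle-qrt : ∀ {v} → c q r ≡ v → c q t ≡ v → c r t ≡ v → HasMonoK3 c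
      triangle-qrt = triangle (<⇒≢ q<r) (<⇒≢ (<-trans q<r r<t)) (<⇒≢ r<t)

    centre-p : (g : Shape k) → triangleShape p q r ≡ g → triangleShape p q t ≡ g →
               triangleShape p r t ≡ g → HasMonoK3 c
    centre-p (true , _ , _) pqr pqt prt =
      triangle-qrt (proj₂ (read-AB _ _ _ pqr)) (proj₂ (read-AB _ _ _ pqt)) (proj₂ (read-AB _ _ _ prt))
    centre-p (false , _ , _) pqr _ prt with read-¬AB _ _ _ pqr
    ... | pq≢pr , pq≡v = contradiction (trans pq≡v (sym (proj₂ (read-¬AB _ _ _ prt)))) pq≢pr

    centre-q : (g : Shape k) → triangleShape p q r ≡ g → triangleShape p q t ≡ g →
               triangleShape q r t ≡ g → HasMonoK3 c
    centre-q (true , _ , _) pqr pqt qrt =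
      triangle-qrt (proj₂ (read-AB _ _ _ pqr)) (proj₂ (read-AB _ _ _ pqt)) (proj₂ (read-AB _ _ _ qrt))
    centre-q (false , true , _) pqr pqt qrt with read-¬AB _ _ _ qrt
    ... | qr≢qt , qr≡v =
      contradiction (trans qr≡v (trans (sym (proj₂ (read-¬AB _ _ _ pqr))) (read-AC _ _ _ pqt))) qr≢qt
    centre-q (false , false , _) pqr _ qrt =
      contradiction (trans (proj₂ (read-¬AB _ _ _ pqr)) (sym (proj₂ (read-¬AB _ _ _ qrt))))
                    (read-¬AC _ _ _ pqr)

    centre-r : (g : Shape k) → triangleShape p q r ≡ g → triangleShape p r t ≡ g →
               triangleShape q r t ≡ g → HasMonoK3 c
    centre-r (true , _ , _) pqr _ qrt with read-AB _ _ _ qrt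
    ... | qr≡qt , rt≡v = triangle-qrt qr≡v (trans (sym qr≡qt) qr≡v) rt≡v
      where qr≡v = proj₂ (read-AB _ _ _ pqr)
    centre-r (false , _ , _) pqr prt _ with read-¬AB _ _ _ pqr
    ... | pq≢pr , pq≡v = contradiction (trans pq≡v (sym (proj₂ (read-¬AB _ _ _ prt)))) pq≢pr

    centre-t : (g : Shape k) → triangleShape p q t ≡ g → triangleShape p r t ≡ g →
               triangleShape q r t ≡ g → HasMonoK3 c
    centre-t (true , _ , _) pqt _ qrt with read-AB _ _ _ qrt
    ... | qr≡qt , rt≡v = triangle-qrt (trans qr≡qt qt≡v) qt≡v rt≡v
      where qt≡v = proj₂ (read-AB _ _ _ pqt)
    centre-t (false , _ , _) pqt prt qrt =
      triangle (<⇒≢ p<q) (<⇒≢ (<-trans p<q q<r)) (<⇒≢ q<r)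
        (proj₂ (read-¬AB _ _ _ pqt)) (proj₂ (read-¬AB _ _ _ prt)) (proj₂ (read-¬AB _ _ _ qrt))

  -- the coded shape of a triple, meaningful when x < y < z
  shapeCode : Fin n → Fin n → Fin n → Fin (4 * k)
  shapeCode x y z = encode (triangleShape x y z)

  colour : Fin n → Fin n → Fin n → Fin (4 * k)
  colour = symmetrise shapeCode

  colour-swap₁₂ : ∀ x y z → colour x y z ≡ colour y x z
  colour-swap₁₂ = symmetrise-swap₁₂ shapeCode

  colour-swap₂₃ : ∀ x y z → colour x y z ≡ colour x z y
  colour-swap₂₃ = symmetrise-swap₂₃ shapeCode

  colour-rotate : ∀ x y z → colour x y z ≡ colour y z x
  colour-rotate x y z = trans (colour-swap₁₂ x y z) (colour-swap₂₃ y x z)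

  colour-sorted : ∀ {x y z} → x <ᶠ y → y <ᶠ z → colour x y z ≡ shapeCode x y z
  colour-sorted = symmetrise-sorted shapeCode

  symColouring : SymColouring3 n (4 * k)
  symColouring = colour , colour-swap₁₂ , colour-swap₂₃

  sameShape : ∀ {x y z x′ y′ z′} {s s′ : Shape k} →
              colour x y z ≡ encode s → colour x′ y′ z′ ≡ encode s′ →
              colour x y z ≡ colour x′ y′ z′ → s′ ≡ s
  sameShape e e′ h = encode-injective (trans (sym e′) (trans (sym h) e))

  starSorted : ∀ {a b c′ d} → b <ᶠ c′ → c′ <ᶠ d → a ≢ b → a ≢ c′ → a ≢ d →
               Star colour a b c′ d → HasMonoK3 c
  starSorted {a} {b} {c′} {d} b<c c<d a≢b a≢c a≢d (h₁ , h₂) with <-cmp a b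
  ... | tri≈ _ a≡b _ = contradiction a≡b a≢b
  ... | tri< a<b _ _ =
    let s₁ = colour-sorted a<b b<c ; s₂ = colour-sorted a<b (<-trans b<c c<d)
        s₃ = colour-sorted (<-trans a<b b<c) c<d
    in centre-p a<b b<c c<d _ refl (sameShape s₁ s₂ h₁) (sameShape s₁ s₃ h₂)
  ... | tri> _ _ b<a with <-cmp a c′
  ... | tri≈ _ a≡c _ = contradiction a≡c a≢c
  ... | tri< a<c _ _ =
    let s₁ = trans (colour-swap₁₂ a b c′) (colour-sorted b<a a<c)
        s₂ = trans (colour-swap₁₂ a b d) (colour-sorted b<a (<-trans a<c c<d))
        s₃ = colour-sorted a<c c<d
    in centre-q b<a a<c c<d _ refl (sameShape s₁ s₂ h₁) (sameShape s₁ s₃ h₂)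
  ... | tri> _ _ c<a with <-cmp a d
  ... | tri≈ _ a≡d _ = contradiction a≡d a≢d
  ... | tri< a<d _ _ =
    let s₁ = trans (colour-rotate a b c′) (colour-sorted b<c c<a)
        s₂ = trans (colour-swap₁₂ a b d) (colour-sorted b<a a<d)
        s₃ = trans (colour-swap₁₂ a c′ d) (colour-sorted c<a a<d)
    in centre-r b<c c<a a<d _ refl (sameShape s₁ s₂ h₁) (sameShape s₁ s₃ h₂)
  ... | tri> _ _ d<a =
    let s₁ = trans (colour-rotate a b c′) (colour-sorted b<c c<a)
        s₂ = trans (colour-rotate a b d) (colour-sorted (<-trans b<c c<d) d<a)
        s₃ = trans (colour-rotate a c′ d) (colour-sorted c<d d<a)
    in centre-t b<c c<d d<a _ refl (sameShape s₁ s₂ h₁) (sameShape s₁ s₃ h₂)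

  monoK3 : HasMonoK43e colour → HasMonoK3 c
  monoK3 (a , b , c′ , d , (a≢b , a≢c , a≢d , b≢c , b≢d , c≢d) , star)
    with sortDistinct {P = Leaves} swapLeaves₁₂ swapLeaves₂₃ b≢c b≢d c≢d ((a≢b , a≢c , a≢d) , star)
    where
    Leaves : Fin n → Fin n → Fin n → Set
    Leaves u v w = (a ≢ u × a ≢ v × a ≢ w) × Star colour a u v w
    swapLeaves₁₂ : ∀ {u v w} → Leaves u v w → Leaves v u w
    swapLeaves₁₂ {u} {v} ((a≢u , a≢v , a≢w) , (h₁ , h₂)) =
      (a≢v , a≢u , a≢w) , (trans (colour-swap₂₃ a v u) h₂ , trans (colour-swap₂₃ a v u) h₁)
    swapLeaves₂₃ : ∀ {u v w} → Leaves u v w → Leaves u w v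
    swapLeaves₂₃ {u} {v} {w} ((a≢u , a≢v , a≢w) , (h₁ , h₂)) =
      (a≢u , a≢w , a≢v) , (sym h₁ , trans (sym h₁) (trans h₂ (colour-swap₂₃ a v w)))
  ... | _ , _ , _ , (u<v , v<w) , ((a≢u , a≢v , a≢w) , star′) = starSorted u<v v<w a≢u a≢v a≢w star′

arrowsK3-fromK43e : ∀ {k n} → ArrowsK43e (4 * k) n → ArrowsK3 k n
arrowsK3-fromK43e arrows (c , _) = ShapeColouring.monoK3 c (arrows (ShapeColouring.symColouring c))

-- r_k(K₄³ - e) ≤ r_k(K₃) + 1: the link of vertex 0 is an edge colouring of
-- the remaining vertices, and a monochromatic triangle there is a
-- monochromatic K₄³ - e centred at 0.
arrowsK43e-fromK3 : ∀ {k s} → ArrowsK3 k s → ArrowsK43e k (1 + s)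
arrowsK43e-fromK3 arrows (col , _ , swap₂₃)
  with arrows ((λ x y → col zero (suc x) (suc y)) , λ x y → swap₂₃ zero (suc x) (suc y))
... | x , y , z , (x≢y , x≢z , y≢z) , star =
  zero , suc x , suc y , suc z ,
  ((λ ()) , (λ ()) , (λ ()) , x≢y ∘ suc-injective , x≢z ∘ suc-injective , y≢z ∘ suc-injective) ,
  star

-- Both arrow properties pass from m vertices to m′ ≥ m vertices: restrict a
-- colouring to the first m vertices.
module _ {m m′ : ℕ} (m≤m′ : m ≤ m′) where
  private
    ι : Fin m → Fin m′
    ι x = inject≤ x m≤m′

    ι-distinct : ∀ {x y} → x ≢ y → ι x ≢ ι y
    ι-distinct x≢y = x≢y ∘ inject≤-injective m≤m′ m≤m′ _ _

  arrowsK3-mono : ∀ {k} → ArrowsK3 k m → ArrowsK3 k m′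
  arrowsK3-mono arrows (c , swap) with arrows ((λ x y → c (ι x) (ι y)) , λ x y → swap (ι x) (ι y))
  ... | x , y , z , (x≢y , x≢z , y≢z) , mono =
    ι x , ι y , ι z , (ι-distinct x≢y , ι-distinct x≢z , ι-distinct y≢z) , mono

  arrowsK43e-mono : ∀ {k} → ArrowsK43e k m → ArrowsK43e k m′
  arrowsK43e-mono arrows (col , swap₁₂ , swap₂₃)
    with arrows ((λ x y z → col (ι x) (ι y) (ι z)) ,
                 (λ x y z → swap₁₂ (ι x) (ι y) (ι z)) , (λ x y z → swap₂₃ (ι x) (ι y) (ι z)))
  ... | a , b , c , d , (a≢b , a≢c , a≢d , b≢c , b≢d , c≢d) , star =
    ι a , ι b , ι c , ι d ,
    (ι-distinct a≢b , ι-distinct a≢c , ι-distinct a≢d , ι-distinct b≢c , ι-distinct b≢d , ι-distinct c≢d) ,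
    star

isMin-≤ : ∀ {P : ℕ → Set} {r s} → IsMin P r → P s → r ≤ s
isMin-≤ {s = s} (_ , below) Ps with _ ≤? s
... | yes r≤s = r≤s
... | no  r≰s = contradiction Ps (below s (≰⇒> r≰s))

isMin-threshold : ∀ {P : ℕ → Set} {r} → (∀ {m m′} → m ≤ m′ → P m → P m′) →
                  P (1 + r) → ¬ P r → IsMin P (1 + r)
isMin-threshold mono P[1+r] ¬P[r] = P[1+r] , λ { m (s≤s m≤r) Pm → ¬P[r] (mono m≤r Pm) }

hasMonoK3? : ∀ {n k} (c : Fin n → Fin n → Fin k) → Dec (HasMonoK3 c)
hasMonoK3? c = any? λ x → any? λ y → any? λ z →
  (¬? (x ≟ y) ×-dec ¬? (x ≟ z) ×-dec ¬? (y ≟ z)) ×-dec (c x y ≟ c x z ×-dec c x y ≟ c y z)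

hasMonoK43e? : ∀ {n k} (col : Fin n → Fin n → Fin n → Fin k) → Dec (HasMonoK43e col)
hasMonoK43e? col = any? λ a → any? λ b → any? λ c → any? λ d →
  (¬? (a ≟ b) ×-dec ¬? (a ≟ c) ×-dec ¬? (a ≟ d) ×-dec ¬? (b ≟ c) ×-dec ¬? (b ≟ d) ×-dec ¬? (c ≟ d))
  ×-dec (col a b c ≟ col a b d ×-dec col a b c ≟ col a c d)

-- K₅ does not arrow K₃ with two colours: colour the edges of a pentagon 1
-- and its diagonals 0.
onPentagon : ℕ → Fin 2
onPentagon 1 = 1F
onPentagon 4 = 1F
onPentagon _ = 0F

pentagon : Fin 5 → Fin 5 → Fin 2
pentagon x y = onPentagon ∣ toℕ x - toℕ y ∣

notArrowsK3-5 : ¬ ArrowsK3 2 5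
notArrowsK3-5 arrows = from-no (hasMonoK3? pentagon) (arrows (pentagon , symmetric))
  where
  symmetric : ∀ x y → pentagon x y ≡ pentagon y x
  symmetric x y = cong onPentagon (∣-∣-comm (toℕ x) (toℕ y))

sumClass : ℕ → Fin 2
sumClass 0 = 1F
sumClass 1 = 1F
sumClass 4 = 1F
sumClass _ = 0F

sumColouring : Fin 6 → Fin 6 → Fin 6 → Fin 2
sumColouring x y z = sumClass ((toℕ x + toℕ y + toℕ z) % 6)

notArrowsK43e-6 : ¬ ArrowsK43e 2 6
notArrowsK43e-6 arrows =
  from-no (hasMonoK43e? sumColouring) (arrows (sumColouring , swap₁₂ , swap₂₃))
  where
  swap₁₂ : ∀ x y z → sumColouring x y z ≡ sumColouring y x z
  swap₁₂ x y z = cong (λ s → sumClass ((s + toℕ z) % 6)) (+-comm (toℕ x) (toℕ y))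
  swap₂₃ : ∀ x y z → sumColouring x y z ≡ sumColouring x z y
  swap₂₃ x y z = cong (λ s → sumClass (s % 6)) (begin
    toℕ x + toℕ y + toℕ z    ≡⟨ +-assoc (toℕ x) (toℕ y) (toℕ z) ⟩
    toℕ x + (toℕ y + toℕ z)  ≡⟨ cong (toℕ x +_) (+-comm (toℕ y) (toℕ z)) ⟩
    toℕ x + (toℕ z + toℕ y)  ≡⟨ +-assoc (toℕ x) (toℕ z) (toℕ y) ⟨
    toℕ x + toℕ z + toℕ y    ∎)
    where open ≡-Reasoning

ThreeAlike : ∀ {m} → (Fin m → Fin 2) → Set
ThreeAlike f = ∃[ i ] ∃[ j ] ∃[ l ] (i ≢ j × i ≢ l × j ≢ l) × (f i ≡ f j × f i ≡ f l)

threeAlike? : ∀ {m} (f : Fin m → Fin 2) → Dec (ThreeAlike f)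
threeAlike? f = any? λ i → any? λ j → any? λ l →
  (¬? (i ≟ j) ×-dec ¬? (i ≟ l) ×-dec ¬? (j ≟ l)) ×-dec (f i ≟ f j ×-dec f i ≟ f l)

pigeonhole-5-2 : (f : Fin 5 → Fin 2) → ThreeAlike f
pigeonhole-5-2 f = fromVector (everyVector (f 0F) (f 1F) (f 2F) (f 3F) (f 4F))
  where
  everyVector : ∀ a b c d e → ThreeAlike (lookup (a ∷ b ∷ c ∷ d ∷ e ∷ []))
  everyVector = from-yes (all? λ a → all? λ b → all? λ c → all? λ d → all? λ e →
    threeAlike? (lookup (a ∷ b ∷ c ∷ d ∷ e ∷ [])))
  fromVector : ThreeAlike (lookup (f 0F ∷ f 1F ∷ f 2F ∷ f 3F ∷ f 4F ∷ [])) → ThreeAlike f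
  fromVector (i , j , l , distinct , (e₁ , e₂)) = i , j , l , distinct ,
    (trans (sym (lookup∘tabulate f i)) (trans e₁ (lookup∘tabulate f j)) ,
     trans (sym (lookup∘tabulate f i)) (trans e₂ (lookup∘tabulate f l)))

twoColours : {a b v : Fin 2} → a ≢ v → b ≢ v → a ≡ b
twoColours {0F} {0F} _ _ = refl
twoColours {1F} {1F} _ _ = refl
twoColours {0F} {1F} {0F} a≢v _ = contradiction refl a≢v
twoColours {0F} {1F} {1F} _ b≢v = contradiction refl b≢v
twoColours {1F} {0F} {0F} _ b≢v = contradiction refl b≢v
twoColours {1F} {0F} {1F} a≢v _ = contradiction refl a≢v

-- In a 2-colouring, a vertex v joined to x, y, z in one colour lies in a
-- monochromatic triangle if some edge among x, y, z has that colour;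
-- otherwise x, y, z span a triangle of the other colour.
monoNeighbours : ∀ {n} (c : Fin n → Fin n → Fin 2) {v x y z : Fin n} →
  v ≢ x → v ≢ y → v ≢ z → x ≢ y → x ≢ z → y ≢ z →
  c v x ≡ c v y → c v x ≡ c v z → HasMonoK3 c
monoNeighbours c {v} {x} {y} {z} v≢x v≢y v≢z x≢y x≢z y≢z vx≡vy vx≡vz
  with c x y ≟ c v x | c x z ≟ c v x | c y z ≟ c v x
... | yes xy | _ | _ = v , x , y , (v≢x , v≢y , x≢y) , (vx≡vy , sym xy)
... | no _ | yes xz | _ = v , x , z , (v≢x , v≢z , x≢z) , (vx≡vz , sym xz)
... | no _ | no _ | yes yz =
  v , y , z , (v≢y , v≢z , y≢z) , (trans (sym vx≡vy) vx≡vz , trans (sym vx≡vy) (sym yz))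
... | no xy | no xz | no yz = x , y , z , (x≢y , x≢z , y≢z) , (twoColours xy xz , twoColours xy yz)

-- K₆ arrows K₃ with two colours: three of the five edges at vertex 0 agree.
arrowsK3-6 : ArrowsK3 2 6
arrowsK3-6 (c , _) = fromNeighbours (pigeonhole-5-2 (λ i → c zero (suc i)))
  where
  fromNeighbours : ThreeAlike (λ i → c zero (suc i)) → HasMonoK3 c
  fromNeighbours (i , j , l , (i≢j , i≢l , j≢l) , (e₁ , e₂)) =
    monoNeighbours c (λ ()) (λ ()) (λ ())
      (i≢j ∘ suc-injective) (i≢l ∘ suc-injective) (j≢l ∘ suc-injective) e₁ e₂

-- The two inequalities hold for every k (the hypothesis 2 ≤ k is not
-- needed); the exact values come from the threshold characterisation.
mainTheorem3 :
    ((k : ℕ) → 2 ≤ k →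
      (∀ r s → IsRamseyK3 k r → IsRamseyK43e (4 * k) s → r ≤ s) ×
      (∀ r s → IsRamseyK43e k r → IsRamseyK3 k s → r ≤ s + 1)) ×
    (IsRamseyK43e 2 7 × IsRamseyK3 2 6)
mainTheorem3 = (λ k _ → lower k , upper k) , (ramseyK43e-2 , ramseyK3-2)
  where
  lower : ∀ k r s → IsRamseyK3 k r → IsRamseyK43e (4 * k) s → r ≤ s
  lower k r s isMinK3 (arrowsK43e , _) = isMin-≤ isMinK3 (arrowsK3-fromK43e arrowsK43e)

  upper : ∀ k r s → IsRamseyK43e k r → IsRamseyK3 k s → r ≤ s + 1
  upper k r s isMinK43e (arrowsK3 , _) =
    subst (r ≤_) (+-comm 1 s) (isMin-≤ isMinK43e (arrowsK43e-fromK3 arrowsK3))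

  ramseyK3-2 : IsRamseyK3 2 6
  ramseyK3-2 = isMin-threshold (λ le → arrowsK3-mono le) arrowsK3-6 notArrowsK3-5

  ramseyK43e-2 : IsRamseyK43e 2 7
  ramseyK43e-2 = isMin-threshold (λ le → arrowsK43e-mono le) (arrowsK43e-fromK3 arrowsK3-6) notArrowsK43e-6
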